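{- Let $\alpha\geq 3$, $p\geq 2$ and $n\geq 2\alpha$ be integers, and set $k=n-\alpha$. Then \[ A(p,n,k)\geq \frac{n!}{\alpha!\,(n-2\alpha)!}\left(\frac{2^p-1}{2}\right)^{\alpha}. \]
   Context: For $n\in\mathbb{N}$ let $S_n$ be the symmetric group on $[n]=\{1,\dots,n\}$. For $p,n\in\mathbb{N}$ let $\mathcal{C}_{p,n}$ be the set of $p$-tuples $(\sigma_1,\dots,\sigma_p)\in(S_n)^p$ with $\sigma_i\sigma_j=\sigma_j\sigma_i$ for all $i,j$. For $1\le k\le n$, $A(p,n,k)$ is the number of tuples in $\mathcal{C}_{p,n}$ such that the subgroup of $S_n$ generated by $\sigma_1,\dots,\sigma_p$ has exactly $k$ orbits on $[n]$. (It is a known identity that $A(p,n,k)=\frac{n!}{k!}\sum_{n_1,\dots,n_k\ge1,\ n_1+\dots+n_k=n}\prod_{i=1}^k\frac{B(p,n_i)}{n_i}$, where $B(p,m)=\sum_{s_1\mid s_2\mid\cdots\mid s_{p-1}\mid m}s_1s_2\cdots s_{p-1}$.) -}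

module Defs where

open import Data.Nat using (ℕ; zero; suc; _<ᵇ_)
open import Data.Bool using (Bool; true; false; _∧_; _∨_; not)
open import Data.Fin using (Fin; toℕ)
open import Data.Fin.Properties using (_≟_)
open import Data.List using (List; []; _∷_; [_]; map; concatMap; allFin; length; filter)
open import Data.Bool.ListAction using (all; any)
open import Data.Vec using (Vec; lookup)
  renaming ([] to []ᵛ; _∷_ to _∷ᵛ_)
open import Relation.Nullary using (does)
open import Relation.Unary using (Pred)
open import Relation.Nullary.Decidable using (yes; no)

infix 4 _=ᶠ_
_=ᶠ_ : ∀ {n} → Fin n → Fin n → Bool
x =ᶠ y = does (x ≟ y)

tuples : ∀ {a} {A : Set a} → List A → (m : ℕ) → List (Vec A m)
tuples xs zero    = [ []ᵛ ]
tuples xs (suc m) = concatMap (λ x → map (x ∷ᵛ_) (tuples xs m)) xs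

-- A self-map of [n] = Fin n is encoded by its table of values  i ↦ lookup f i.
Map : ℕ → Set
Map n = Vec (Fin n) n

infixl 9 _⟨_⟩
_⟨_⟩ : ∀ {n} → Map n → Fin n → Fin n
f ⟨ i ⟩ = lookup f i

-- f is a permutation of Fin n (injective, hence bijective since Fin n is finite).
isPerm : ∀ {n} → Map n → Bool
isPerm {n} f = all (λ x → all (λ y → not (f ⟨ x ⟩ =ᶠ f ⟨ y ⟩) ∨ (x =ᶠ y)) (allFin n)) (allFin n)

Sym : (n : ℕ) → List (Map n)
Sym n = filter (λ f → isPerm f Data.Bool.≟ true) (tuples (allFin n) n)

commute : ∀ {n} → Map n → Map n → Bool
commute {n} f g = all (λ x → f ⟨ g ⟨ x ⟩ ⟩ =ᶠ g ⟨ f ⟨ x ⟩ ⟩) (allFin n)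

pairwiseCommute : ∀ {n m} → Vec (Map n) m → Bool
pairwiseCommute {n} {m} σ =
  all (λ i → all (λ j → commute (lookup σ i) (lookup σ j)) (allFin m)) (allFin m)

reach : ∀ {n m} → Vec (Map n) m → ℕ → Fin n → Fin n → Bool
reach σ zero    x y = x =ᶠ y
reach {n} {m} σ (suc t) x y =
  reach σ t x y ∨ any (λ i → reach σ t (lookup σ i ⟨ x ⟩) y) (allFin m)

-- Same orbit of ⟨σ_1,…,σ_m⟩ (for permutations of a finite set the generated
-- group is the monoid generated, and paths of length ≤ n suffice).
sameOrbit : ∀ {n m} → Vec (Map n) m → Fin n → Fin n → Bool
sameOrbit {n} σ x y = reach σ n x y

-- Number of orbits = number of points that are the least element of their orbit.
numOrbits : ∀ {n m} → Vec (Map n) m → ℕ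
numOrbits {n} σ =
  length (filter (λ x → all (λ y → not ((toℕ y <ᵇ toℕ x) ∧ sameOrbit σ x y)) (allFin n)
                          Data.Bool.≟ true)
                 (allFin n))

C : (p n : ℕ) → List (Vec (Map n) p)
C p n = filter (λ σ → pairwiseCommute σ Data.Bool.≟ true) (tuples (Sym n) p)

A : (p n k : ℕ) → ℕ
A p n k = length (filter (λ σ → numOrbits σ Data.Nat.≟ k) (C p n))

-- Attach to each edge of a partial matching of [n] with α edges a nonzero label v ∈ {0,1}^p, and
-- let σᵢ be the product of the transpositions of the edges whose label has vᵢ = 1.  The σᵢ are
-- commuting involutions whose orbits are the α edges and the n − 2α unmatched points, so they
-- generate a group with n − α orbits; and the tuple (σ₁,…,σₚ) determines the labelled matching.
-- Hence A(p,n,n−α) is at least the number of such labelled matchings, which is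
-- n! / (α! (n − 2α)! 2^α) · (2^p − 1)^α.
module Submission where

open import Defs
open import Data.Bool using (Bool; true; false; T; not; _∧_; _∨_; if_then_else_)
import Data.Bool as Bool
open import Data.Bool.ListAction using (all)
open import Data.Bool.Properties using (T-≡; T-∨)
open import Data.Fin using (Fin; toℕ) renaming (zero to fzero; suc to fsuc)
open import Data.Fin.Properties using (_≟_) renaming (<-cmp to <-cmpᶠ)
open import Data.List using (List; []; _∷_; [_]; _++_; map; concatMap; length; filter; allFin)
open import Data.List.Membership.Propositional using (_∈_)
open import Data.List.Membership.Propositional.Properties
  using (∈-map⁺; ∈-map⁻; ∈-∃++; ∈-++⁻; ∈-++⁺ˡ; ∈-++⁺ʳ; ∈-filter⁺; ∈-concatMap⁺; ∈-allFin)
open import Data.List.Properties using (length-++; length-map; length-++-sucʳ; length-tabulate)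
open import Data.List.Relation.Binary.Subset.Propositional using (_⊆_)
open import Data.List.Relation.Unary.All as All using (All; []; _∷_)
import Data.List.Relation.Unary.All.Properties as All
open import Data.List.Relation.Unary.AllPairs as AllPairs using (AllPairs; []; _∷_)
import Data.List.Relation.Unary.AllPairs.Properties as AllPairs
open import Data.List.Relation.Unary.Any as Any using (here; there)
import Data.List.Relation.Unary.Any.Properties as Any
open import Data.List.Relation.Unary.Unique.Propositional using (Unique)
import Data.List.Relation.Unary.Unique.Propositional.Properties as Unique
open import Data.Maybe as Maybe using (Maybe; just; nothing; maybe′; is-just)
open import Data.Maybe.Properties using (just-injective)
open import Data.Nat using (ℕ; zero; suc; _+_; _*_; _∸_; _^_; _≤_; _≥_; _<_; _<ᵇ_; _!; z≤n; s≤s; s≤s⁻¹)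
open import Data.Nat.Properties
  using (+-suc; +-identityʳ; *-zeroʳ; *-assoc; *-distribʳ-+; *-monoˡ-≤; ≤-reflexive; <-irrefl; <-asym; <-trans;
         n<1+n; <ᵇ⇒<; <⇒<ᵇ; m+n∸n≡m; m+n∸m≡n; m≤n⇒∃[o]m+o≡n; module ≤-Reasoning)
open import Data.Nat.Tactic.RingSolver using (solve-∀)
open import Data.Product using (∃; _×_; _,_; proj₁; proj₂)
open import Data.Sum using (_⊎_; inj₁; inj₂)
open import Data.Vec using (Vec; lookup; tabulate) renaming ([] to []ᵛ; _∷_ to _∷ᵛ_; allFin to allFinᵛ)
open import Data.Vec.Properties using (∷-injectiveˡ; ∷-injectiveʳ; lookup∘tabulate; tabulate∘lookup; tabulate-cong)
open import Data.Vec.Relation.Unary.All as Allᵛ using () renaming (All to Allᵛ)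
open import Data.Vec.Relation.Unary.AllPairs using (_∷_)
open import Data.Vec.Relation.Unary.Unique.Propositional using () renaming (Unique to Uniqueᵛ)
import Data.Vec.Relation.Unary.Unique.Propositional.Properties as Uniqueᵛ
open import Function using (id; _∘_; _on_; case_of_)
open import Function.Bundles using (Equivalence)
open import Relation.Binary using (Reflexive; Transitive; tri<; tri≈; tri>)
open import Relation.Binary.PropositionalEquality
  using (_≡_; _≢_; refl; sym; trans; cong; cong₂; subst; _≗_; module ≡-Reasoning)
open import Relation.Nullary using (¬_; yes; no; contradiction)

private variable
  X : Set

¬T⇒≡false : ∀ {b} → ¬ T b → b ≡ false
¬T⇒≡false {false} _  = refl
¬T⇒≡false {true}  ¬t = contradiction _ ¬t

T-not-∧⁺ : ∀ {a b} → (T a → ¬ T b) → T (not (a ∧ b))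
T-not-∧⁺ {false}         _ = _
T-not-∧⁺ {true}  {false} _ = _
T-not-∧⁺ {true}  {true}  h = h _ _

T-not-∧⁻ : ∀ {a b} → T (not (a ∧ b)) → T a → ¬ T b
T-not-∧⁻ {true} {true} ()

<ᵇ-irrefl : ∀ m → (m <ᵇ m) ≡ false
<ᵇ-irrefl m = ¬T⇒≡false (<-irrefl refl ∘ <ᵇ⇒< m m)

<ᵇ-asym : ∀ {m k} → m < k → (k <ᵇ m) ≡ false
<ᵇ-asym {m} {k} m<k = ¬T⇒≡false (<-asym m<k ∘ <ᵇ⇒< k m)

if-injective : ∀ {w z : X} {a b} → w ≢ z → (if a then w else z) ≡ (if b then w else z) → a ≡ b
if-injective {a = true}  {true}  _   _  = refl
if-injective {a = false} {false} _   _  = refl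
if-injective {a = true}  {false} w≢z eq = contradiction eq w≢z
if-injective {a = false} {true}  w≢z eq = contradiction (sym eq) w≢z

all-intro : ∀ {p : X → Bool} xs → (∀ x → T (p x)) → T (all p xs)
all-intro {p = p} xs h = All.all⁻ p (All.universal h xs)

-- Written so that numOrbits σ is definitionally count (orbitMinimal σ) (allFin n).
count : (X → Bool) → List X → ℕ
count f xs = length (filter (λ x → f x Bool.≟ true) xs)

count-cong : ∀ {f g : X → Bool} {xs} → All (λ x → f x ≡ g x) xs → count f xs ≡ count g xs
count-cong {f = f} {g} {[]}     []             = refl
count-cong {f = f} {g} {x ∷ xs} (fx≡gx ∷ eqs) with f x | g x | count-cong eqs
... | true  | true  | eq = cong suc eq
... | false | false | eq = eq
... | true  | false | _  = contradiction fx≡gx λ ()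
... | false | true  | _  = contradiction fx≡gx λ ()

count-none : ∀ {f : X → Bool} {xs} → All (λ x → f x ≡ false) xs → count f xs ≡ 0
count-none {f = f} {[]}     []               = refl
count-none {f = f} {x ∷ xs} (fx≡false ∷ fxs) rewrite fx≡false = count-none fxs

count-complement : ∀ (f : X → Bool) xs → count (not ∘ f) xs + count f xs ≡ length xs
count-complement f []       = refl
count-complement f (x ∷ xs) with f x | count-complement f xs
... | true  | eq = trans (+-suc _ _) (cong suc eq)
... | false | eq = cong suc eq

count-insert : ∀ {f g : X → Bool} {t xs} → Unique xs → t ∈ xs → f t ≡ true → g t ≡ false →
               (∀ {z} → z ≢ t → f z ≡ g z) → count f xs ≡ suc (count g xs)
count-insert (t∉xs ∷ _) (here refl) ft gt agree rewrite ft | gt =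
  cong suc (count-cong (All.map (λ t≢z → agree (t≢z ∘ sym)) t∉xs))
count-insert {f = f} {g} {xs = x ∷ _} (x∉xs ∷ u) (there t∈xs) ft gt agree
  with f x | g x | agree (All.lookup x∉xs t∈xs) | count-insert u t∈xs ft gt agree
... | true  | true  | _     | eq = cong suc eq
... | false | false | _     | eq = eq
... | true  | false | fx≡gx | _  = contradiction fx≡gx λ ()
... | false | true  | fx≡gx | _  = contradiction fx≡gx λ ()

Unique-⊆⇒length≤ : ∀ {xs ys : List X} → Unique ys → ys ⊆ xs → length ys ≤ length xs
Unique-⊆⇒length≤ [] _ = z≤n
Unique-⊆⇒length≤ {ys = y ∷ ys} (y∉ys ∷ u) y∷ys⊆xs
  with as , bs , refl ← ∈-∃++ (y∷ys⊆xs (here refl)) =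
  subst (suc (length ys) ≤_) (sym (length-++-sucʳ as y bs))
    (s≤s (Unique-⊆⇒length≤ u λ z∈ys → delete (y∷ys⊆xs (there z∈ys)) (All.lookup y∉ys z∈ys)))
  where
  delete : ∀ {z} → z ∈ as ++ y ∷ bs → y ≢ z → z ∈ as ++ bs
  delete z∈ y≢z with ∈-++⁻ as z∈
  ... | inj₁ z∈as         = ∈-++⁺ˡ z∈as
  ... | inj₂ (here z≡y)   = contradiction (sym z≡y) y≢z
  ... | inj₂ (there z∈bs) = ∈-++⁺ʳ as z∈bs

length-concatMap : ∀ {Y : Set} (f : X → List Y) {k} → (∀ x → length (f x) ≡ k) →
                   ∀ xs → length (concatMap f xs) ≡ length xs * k
length-concatMap f _        []       = refl
length-concatMap f length-f (x ∷ xs) =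
  trans (length-++ (f x)) (cong₂ _+_ (length-f x) (length-concatMap f length-f xs))

All-concatMap⁺ : ∀ {Y : Set} {P : Y → Set} {f : X → List Y} {xs} → All (All P ∘ f) xs → All P (concatMap f xs)
All-concatMap⁺ = All.concat⁺ ∘ All.map⁺

AllPairs-concatMap⁺ : ∀ {Y : Set} {R : Y → Y → Set} {f : X → List Y} {xs} → All (AllPairs R ∘ f) xs →
                      AllPairs (λ a b → All (λ u → All (R u) (f b)) (f a)) xs → AllPairs R (concatMap f xs)
AllPairs-concatMap⁺ within across = AllPairs.concat⁺ (All.map⁺ within) (AllPairs.map⁺ across)

AllPairs-mapWithAll : ∀ {P : X → Set} {R S : X → X → Set} → (∀ {a b} → P a → P b → R a b → S a b) →
                      ∀ {xs} → All P xs → AllPairs R xs → AllPairs S xs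
AllPairs-mapWithAll f []         []         = []
AllPairs-mapWithAll f (pa ∷ pas) (ra ∷ ras) =
  All.zipWith (λ (pb , rab) → f pa pb rab) (pas , ra) ∷ AllPairs-mapWithAll f pas ras

data Pick {X : Set} : ∀ {m} → Vec X (suc m) → X → Vec X m → Set where
  here  : ∀ {m x} {xs : Vec X m} → Pick (x ∷ᵛ xs) x xs
  there : ∀ {m x y} {xs : Vec X (suc m)} {ys} → Pick xs y ys → Pick (x ∷ᵛ xs) y (x ∷ᵛ ys)

picks : ∀ {m} → Vec X (suc m) → List (X × Vec X m)
picks {m = zero}  (x ∷ᵛ []ᵛ) = [ x , []ᵛ ]
picks {m = suc m} (x ∷ᵛ xs)  = (x , xs) ∷ map (λ (y , ys) → y , x ∷ᵛ ys) (picks xs)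

length-picks : ∀ {m} (xs : Vec X (suc m)) → length (picks xs) ≡ suc m
length-picks {m = zero}  (x ∷ᵛ []ᵛ) = refl
length-picks {m = suc m} (x ∷ᵛ xs)  = cong suc (trans (length-map _ (picks xs)) (length-picks xs))

picks-Pick : ∀ {m} (xs : Vec X (suc m)) → All (λ (y , ys) → Pick xs y ys) (picks xs)
picks-Pick {m = zero}  (x ∷ᵛ []ᵛ) = here ∷ []
picks-Pick {m = suc m} (x ∷ᵛ xs)  = here ∷ All.map⁺ (All.map there (picks-Pick xs))

Pick-avoids : ∀ {m y z} {xs : Vec X (suc m)} {ys} → Pick xs y ys → Allᵛ (z ≢_) xs → Allᵛ (z ≢_) (y ∷ᵛ ys)
Pick-avoids here         z∉xs                = z∉xs
Pick-avoids (there pick) (z≢x Allᵛ.∷ z∉xs)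
  with z≢y Allᵛ.∷ z∉ys ← Pick-avoids pick z∉xs = z≢y Allᵛ.∷ z≢x Allᵛ.∷ z∉ys

Pick-unique : ∀ {m y} {xs : Vec X (suc m)} {ys} → Pick xs y ys → Uniqueᵛ xs → Uniqueᵛ (y ∷ᵛ ys)
Pick-unique here         u          = u
Pick-unique (there pick) (x∉xs ∷ u)
  with y∉ys ∷ u′ ← Pick-unique pick u | x≢y Allᵛ.∷ x∉ys ← Pick-avoids pick x∉xs =
  ((x≢y ∘ sym) Allᵛ.∷ y∉ys) ∷ (x∉ys ∷ u′)

picks-distinct : ∀ {m} {xs : Vec X (suc m)} → Uniqueᵛ xs → AllPairs (_≢_ on proj₁) (picks xs)
picks-distinct {m = zero}  {x ∷ᵛ []ᵛ} _          = [] ∷ []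
picks-distinct {m = suc m} {x ∷ᵛ xs}  (x∉xs ∷ u) =
  All.map⁺ (All.map (λ pick → Allᵛ.head (Pick-avoids pick x∉xs)) (picks-Pick xs))
  ∷ AllPairs.map⁺ (picks-distinct u)

Nonzero : ∀ {p} → Vec Bool p → Set
Nonzero v = ∃ λ i → T (lookup v i)

bitVectors : (p : ℕ) → List (Vec Bool p)
bitVectors zero    = [ []ᵛ ]
bitVectors (suc p) = map (true ∷ᵛ_) (bitVectors p) ++ map (false ∷ᵛ_) (bitVectors p)

nonzeroBitVectors : (p : ℕ) → List (Vec Bool p)
nonzeroBitVectors zero    = []
nonzeroBitVectors (suc p) = map (true ∷ᵛ_) (bitVectors p) ++ map (false ∷ᵛ_) (nonzeroBitVectors p)

length-split : ∀ {p} (us vs : List (Vec Bool p)) →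
               length (map (true ∷ᵛ_) us ++ map (false ∷ᵛ_) vs) ≡ length us + length vs
length-split us vs = trans (length-++ (map (true ∷ᵛ_) us)) (cong₂ _+_ (length-map _ us) (length-map _ vs))

length-bitVectors : ∀ p → length (bitVectors p) ≡ 2 ^ p
length-bitVectors zero    = refl
length-bitVectors (suc p) = begin
  length (bitVectors (suc p))                   ≡⟨ length-split (bitVectors p) (bitVectors p) ⟩
  length (bitVectors p) + length (bitVectors p) ≡⟨ cong₂ _+_ 2^p (trans 2^p (sym (+-identityʳ _))) ⟩
  2 ^ p + (2 ^ p + 0)                           ∎
  where
  open ≡-Reasoning
  2^p : length (bitVectors p) ≡ 2 ^ p
  2^p = length-bitVectors p

length-nonzeroBitVectors : ∀ p → length (nonzeroBitVectors p) ≡ 2 ^ p ∸ 1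
length-nonzeroBitVectors p = cong (_∸ 1) (suc-length p)
  where
  open ≡-Reasoning
  suc-length : ∀ p → suc (length (nonzeroBitVectors p)) ≡ 2 ^ p
  suc-length zero    = refl
  suc-length (suc p) = begin
    suc (length (nonzeroBitVectors (suc p)))                   ≡⟨ cong suc (length-split (bitVectors p) _) ⟩
    suc (length (bitVectors p) + length (nonzeroBitVectors p)) ≡⟨ +-suc (length (bitVectors p)) _ ⟨
    length (bitVectors p) + suc (length (nonzeroBitVectors p))
      ≡⟨ cong₂ _+_ (length-bitVectors p) (trans (suc-length p) (sym (+-identityʳ _))) ⟩
    2 ^ p + (2 ^ p + 0)                                        ∎

Unique-split : ∀ {p} {us vs : List (Vec Bool p)} → Unique us → Unique vs →
               Unique (map (true ∷ᵛ_) us ++ map (false ∷ᵛ_) vs)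
Unique-split uus uvs = Unique.++⁺ (Unique.map⁺ ∷-injectiveʳ uus) (Unique.map⁺ ∷-injectiveʳ uvs) disjoint
  where
  disjoint : ∀ {w} → ¬ (w ∈ map (true ∷ᵛ_) _ × w ∈ map (false ∷ᵛ_) _)
  disjoint (w∈us , w∈vs) with ∈-map⁻ (true ∷ᵛ_) w∈us | ∈-map⁻ (false ∷ᵛ_) w∈vs
  ... | _ , _ , refl | _ , _ , eq = contradiction (∷-injectiveˡ eq) λ ()

Unique-bitVectors : ∀ p → Unique (bitVectors p)
Unique-bitVectors zero    = [] ∷ []
Unique-bitVectors (suc p) = Unique-split (Unique-bitVectors p) (Unique-bitVectors p)

Unique-nonzeroBitVectors : ∀ p → Unique (nonzeroBitVectors p)
Unique-nonzeroBitVectors zero    = []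
Unique-nonzeroBitVectors (suc p) = Unique-split (Unique-bitVectors p) (Unique-nonzeroBitVectors p)

nonzeroBitVectors-nonzero : ∀ p → All Nonzero (nonzeroBitVectors p)
nonzeroBitVectors-nonzero zero    = []
nonzeroBitVectors-nonzero (suc p) = All.++⁺
  (All.map⁺ (All.universal (λ _ → fzero , _) (bitVectors p)))
  (All.map⁺ (All.map (λ (i , vᵢ) → fsuc i , vᵢ) (nonzeroBitVectors-nonzero p)))

-- Commuting tuples and orbits

≡⇒=ᶠ : ∀ {n} {x y : Fin n} → x ≡ y → T (x =ᶠ y)
≡⇒=ᶠ {x = x} {y} x≡y with x ≟ y
... | yes _  = _
... | no x≢y = x≢y x≡y

=ᶠ⇒≡ : ∀ {n} {x y : Fin n} → T (x =ᶠ y) → x ≡ y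
=ᶠ⇒≡ {x = x} {y} _ with x ≟ y
... | yes x≡y = x≡y

isPerm-intro : ∀ {n} {f : Map n} → (∀ {x y} → f ⟨ x ⟩ ≡ f ⟨ y ⟩ → x ≡ y) → T (isPerm f)
isPerm-intro {n} {f} injective = all-intro (allFin n) λ x → all-intro (allFin n) (clause x)
  where
  clause : ∀ x y → T (not (f ⟨ x ⟩ =ᶠ f ⟨ y ⟩) ∨ (x =ᶠ y))
  clause x y with f ⟨ x ⟩ ≟ f ⟨ y ⟩
  ... | no _      = _
  ... | yes fx≡fy = ≡⇒=ᶠ (injective fx≡fy)

pairwiseCommute-intro : ∀ {n m} {σ : Vec (Map n) m} →
                        (∀ i j x → lookup σ i ⟨ lookup σ j ⟨ x ⟩ ⟩ ≡ lookup σ j ⟨ lookup σ i ⟨ x ⟩ ⟩) →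
                        T (pairwiseCommute σ)
pairwiseCommute-intro {n} {m} comm =
  all-intro (allFin m) λ i → all-intro (allFin m) λ j → all-intro (allFin n) λ x → ≡⇒=ᶠ (comm i j x)

∈-tuples : ∀ {xs : List X} {m} (v : Vec X m) → (∀ i → lookup v i ∈ xs) → v ∈ tuples xs m
∈-tuples []ᵛ _ = here refl
∈-tuples {xs = xs} {suc m} (x ∷ᵛ v) v⊆xs = ∈-concatMap⁺ (λ y → map (y ∷ᵛ_) (tuples xs m))
  (Any.map (λ { refl → ∈-map⁺ (x ∷ᵛ_) (∈-tuples v (v⊆xs ∘ fsuc)) }) (v⊆xs fzero))

∈-C : ∀ {n m} {σ : Vec (Map n) m} → (∀ i → T (isPerm (lookup σ i))) → T (pairwiseCommute σ) → σ ∈ C m n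
∈-C {σ = σ} perm comm = ∈-filter⁺ _ (∈-tuples σ σᵢ∈Sym) (Equivalence.to T-≡ comm)
  where
  σᵢ∈Sym : ∀ i → lookup σ i ∈ Sym _
  σᵢ∈Sym i =
    ∈-filter⁺ _ (∈-tuples (lookup σ i) (∈-allFin ∘ lookup (lookup σ i))) (Equivalence.to T-≡ (perm i))

orbitMinimal : ∀ {n m} → Vec (Map n) m → Fin n → Bool
orbitMinimal {n} σ x = all (λ y → not ((toℕ y <ᵇ toℕ x) ∧ sameOrbit σ x y)) (allFin n)

module _ {n m} {σ : Vec (Map n) m} where

  reach-refl : ∀ t z → T (reach σ t z z)
  reach-refl zero    z = ≡⇒=ᶠ {x = z} refl
  reach-refl (suc t) z = Equivalence.from T-∨ (inj₁ (reach-refl t z))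

  reach-sound : (_~_ : Fin n → Fin n → Set) → Reflexive _~_ → Transitive _~_ →
                (∀ i z → z ~ (lookup σ i ⟨ z ⟩)) → ∀ t {z w} → T (reach σ t z w) → z ~ w
  reach-sound _~_ ~-refl ~-trans step zero    {z} r = subst (z ~_) (=ᶠ⇒≡ r) ~-refl
  reach-sound _~_ ~-refl ~-trans step (suc t) r with Equivalence.to T-∨ r
  ... | inj₁ r′ = reach-sound _~_ ~-refl ~-trans step t r′
  ... | inj₂ r′ with i , r″ ← Any.satisfied (Any.any⁻ _ (allFin m) r′) =
    ~-trans (step i _) (reach-sound _~_ ~-refl ~-trans step t r″)

sameOrbit-generator : ∀ {n m} {σ : Vec (Map n) m} i z → T (sameOrbit σ z (lookup σ i ⟨ z ⟩))
sameOrbit-generator {suc n} i z =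
  Equivalence.from T-∨ (inj₂ (Any.any⁺ _ (Any.map (λ { refl → reach-refl n _ }) (∈-allFin i))))

-- Counting labelled matchings

-- The number of α-edge matchings on m points with c labels per edge: the first point is either
-- unmatched or matched to one of the other m − 1 points.
matchingCount : ℕ → ℕ → ℕ → ℕ
matchingCount c m             zero    = 1
matchingCount c zero          (suc α) = 0
matchingCount c (suc zero)    (suc α) = 0
matchingCount c (suc (suc m)) (suc α) = matchingCount c (suc m) (suc α) + suc m * (c * matchingCount c m α)

module _ (c : ℕ) where

  matchingCount-vanishes : ∀ m α → m < 2 * α → matchingCount c m α ≡ 0
  matchingCount-vanishes m             zero    ()
  matchingCount-vanishes zero          (suc α) _ = refl
  matchingCount-vanishes (suc zero)    (suc α) _ = refl
  matchingCount-vanishes (suc (suc m)) (suc α) ssm<2α+2 = begin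
    matchingCount c (suc m) (suc α) + suc m * (c * matchingCount c m α)
      ≡⟨ cong₂ (λ a b → a + suc m * (c * b))
               (matchingCount-vanishes (suc m) (suc α) (<-trans (n<1+n _) ssm<2α+2))
               (matchingCount-vanishes m α m<2α) ⟩
    suc m * (c * 0) ≡⟨ cong (suc m *_) (*-zeroʳ c) ⟩
    suc m * 0       ≡⟨ *-zeroʳ (suc m) ⟩
    0               ∎
    where
    open ≡-Reasoning
    m<2α : m < 2 * α
    m<2α = s≤s⁻¹ (subst (suc (suc m) ≤_) (+-suc α (α + 0)) (s≤s⁻¹ ssm<2α+2))

  matchingCount-closed : ∀ α r → matchingCount c (2 * α + r) α * (α ! * r ! * 2 ^ α) ≡ (2 * α + r) ! * c ^ α
  matchingCount-closed zero    r = unit-factors (r !)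
    where
    unit-factors : ∀ a → 1 * (1 * a * 1) ≡ a * 1
    unit-factors = solve-∀
  matchingCount-closed (suc α) r = begin
    matchingCount c (2 * suc α + r) (suc α) * W
      ≡⟨ cong (λ k → matchingCount c k (suc α) * W) (two-suc α r) ⟩
    (matchingCount c (suc m) (suc α) + suc m * (c * matchingCount c m α)) * W
      ≡⟨ *-distribʳ-+ W (matchingCount c (suc m) (suc α)) _ ⟩
    matchingCount c (suc m) (suc α) * W + suc m * (c * matchingCount c m α) * W
      ≡⟨ cong₂ _+_ (first-unmatched r) first-matched ⟩
    r * Q + 2 * suc α * Q
      ≡⟨ *-distribʳ-+ Q r (2 * suc α) ⟨
    (r + 2 * suc α) * Q
      ≡⟨ cong (_* Q) (sum-of-parts α r) ⟩
    suc (suc m) * ((suc m) ! * c ^ suc α)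
      ≡⟨ *-assoc (suc (suc m)) ((suc m) !) (c ^ suc α) ⟨
    (suc (suc m)) ! * c ^ suc α
      ≡⟨ cong (λ k → k ! * c ^ suc α) (two-suc α r) ⟨
    (2 * suc α + r) ! * c ^ suc α ∎
    where
    open ≡-Reasoning
    m : ℕ
    m = 2 * α + r
    W : ℕ
    W = suc α ! * r ! * 2 ^ suc α
    Q : ℕ
    Q = (suc m) ! * c ^ suc α

    two-suc : ∀ α r → 2 * suc α + r ≡ suc (suc (2 * α + r))
    two-suc = solve-∀
    sum-of-parts : ∀ α r → r + 2 * suc α ≡ suc (suc (2 * α + r))
    sum-of-parts = solve-∀

    first-unmatched : ∀ r → matchingCount c (suc (2 * α + r)) (suc α) * (suc α ! * r ! * 2 ^ suc α)
                            ≡ r * ((suc (2 * α + r)) ! * c ^ suc α)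
    first-unmatched zero = cong (_* (suc α ! * 1 * 2 ^ suc α))
      (matchingCount-vanishes (suc (2 * α + 0)) (suc α) (≤-reflexive (two-suc′ α)))
      where
      two-suc′ : ∀ α → suc (suc (2 * α + 0)) ≡ 2 * suc α
      two-suc′ = solve-∀
    first-unmatched (suc r) = begin
      matchingCount c k (suc α) * (suc α ! * (suc r * r !) * 2 ^ suc α)
        ≡⟨ pull-out (matchingCount c k (suc α)) (suc α !) (r !) (2 ^ suc α) (suc r) ⟩
      suc r * (matchingCount c k (suc α) * (suc α ! * r ! * 2 ^ suc α))
        ≡⟨ cong (suc r *_) (subst (λ j → matchingCount c j (suc α) * (suc α ! * r ! * 2 ^ suc α) ≡ j ! * c ^ suc α)
                             (sym (shift α r)) (matchingCount-closed (suc α) r)) ⟩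
      suc r * (k ! * c ^ suc α) ∎
      where
      k : ℕ
      k = suc (2 * α + suc r)
      shift : ∀ α r → suc (2 * α + suc r) ≡ 2 * suc α + r
      shift = solve-∀
      pull-out : ∀ a b d e s → a * (b * (s * d) * e) ≡ s * (a * (b * d * e))
      pull-out = solve-∀

    first-matched : suc m * (c * matchingCount c m α) * W ≡ 2 * suc α * Q
    first-matched = begin
      suc m * (c * matchingCount c m α) * (suc α * α ! * r ! * (2 * 2 ^ α))
        ≡⟨ regroup (suc m) c (matchingCount c m α) α (α !) (r !) (2 ^ α) ⟩
      2 * suc α * (suc m * c) * (matchingCount c m α * (α ! * r ! * 2 ^ α))
        ≡⟨ cong (2 * suc α * (suc m * c) *_) (matchingCount-closed α r) ⟩
      2 * suc α * (suc m * c) * (m ! * c ^ α)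
        ≡⟨ regroup′ (2 * suc α) (suc m) c (m !) (c ^ α) ⟩
      2 * suc α * (suc m * m ! * (c * c ^ α)) ∎
      where
      regroup : ∀ s c M a F R P → s * (c * M) * (suc a * F * R * (2 * P)) ≡ 2 * suc a * (s * c) * (M * (F * R * P))
      regroup = solve-∀
      regroup′ : ∀ t s c F C → t * (s * c) * (F * C) ≡ t * (s * F * (c * C))
      regroup′ = solve-∀

-- Labelled matchings and their tuples

-- An edge (x , y , v) of a labelled matching on Fin n; the label v says which σᵢ swap x and y.
EdgeList : ℕ → ℕ → Set
EdgeList n p = List (Fin n × Fin n × Vec Bool p)

module _ {n p : ℕ} where

  Fresh : Fin n → EdgeList n p → Set
  Fresh z = All (λ (x , y , _) → z ≢ x × z ≢ y)

  data Matching : EdgeList n p → Set where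
    []  : Matching []
    add : ∀ {x y v es} → x ≢ y → Fresh x es → Fresh y es → Nonzero v → Matching es →
          Matching ((x , y , v) ∷ es)

  edgeAt : EdgeList n p → Fin n → Maybe (Fin n × Vec Bool p)
  edgeAt []                 z = nothing
  edgeAt ((x , y , v) ∷ es) z with z ≟ x | z ≟ y
  ... | yes _ | _     = just (y , v)
  ... | no _  | yes _ = just (x , v)
  ... | no _  | no _  = edgeAt es z

  partner : EdgeList n p → Fin n → Fin n
  partner es z = maybe′ proj₁ z (edgeAt es z)

  act : Fin p → EdgeList n p → Fin n → Fin n
  act i es z = maybe′ (λ (w , v) → if lookup v i then w else z) z (edgeAt es z)

  toTuple : EdgeList n p → Vec (Map n) p
  toTuple es = tabulate (λ i → tabulate (act i es))

  module _ {x y : Fin n} {v : Vec Bool p} {es : EdgeList n p} where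

    edgeAt-left : edgeAt ((x , y , v) ∷ es) x ≡ just (y , v)
    edgeAt-left with x ≟ x
    ... | yes _  = refl
    ... | no x≢x = contradiction refl x≢x

    edgeAt-right : x ≢ y → edgeAt ((x , y , v) ∷ es) y ≡ just (x , v)
    edgeAt-right x≢y with y ≟ x | y ≟ y
    ... | yes y≡x | _      = contradiction (sym y≡x) x≢y
    ... | no _    | yes _  = refl
    ... | no _    | no y≢y = contradiction refl y≢y

    edgeAt-other : ∀ {z} → z ≢ x → z ≢ y → edgeAt ((x , y , v) ∷ es) z ≡ edgeAt es z
    edgeAt-other {z} z≢x z≢y with z ≟ x | z ≟ y
    ... | yes z≡x | _       = contradiction z≡x z≢x
    ... | no _    | yes z≡y = contradiction z≡y z≢y
    ... | no _    | no _    = refl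

  edgeAt-fresh : ∀ {z es} → Fresh z es → edgeAt es z ≡ nothing
  edgeAt-fresh []                      = refl
  edgeAt-fresh ((z≢x , z≢y) ∷ z-fresh) = trans (edgeAt-other z≢x z≢y) (edgeAt-fresh z-fresh)

  edgeAt-edge : ∀ {es z w v} → Matching es → edgeAt es z ≡ just (w , v) →
                w ≢ z × Nonzero v × edgeAt es w ≡ just (z , v)
  edgeAt-edge {(x , y , _) ∷ es} {z} {w} (add x≢y x-fresh y-fresh nz μ) eq with z ≟ x | z ≟ y | eq
  ... | yes refl | _        | refl = x≢y ∘ sym , nz , edgeAt-right x≢y
  ... | no _     | yes refl | refl = x≢y , nz , edgeAt-left {x = x} {es = es}
  ... | no z≢x   | no z≢y   | eq′ with w≢z , nz′ , eq-w ← edgeAt-edge μ eq′ =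
    w≢z , nz′ , trans (edgeAt-other (endpoint x-fresh) (endpoint y-fresh)) eq-w
    where
    endpoint : ∀ {u} → Fresh u es → w ≢ u
    endpoint u-fresh refl = contradiction (trans (sym eq-w) (edgeAt-fresh u-fresh)) λ ()

  module _ {es : EdgeList n p} where

    act-fixed : ∀ {i z} → edgeAt es z ≡ nothing → act i es z ≡ z
    act-fixed eq = cong (maybe′ _ _) eq

    act-moved : ∀ {i z w v} → edgeAt es z ≡ just (w , v) → act i es z ≡ (if lookup v i then w else z)
    act-moved eq = cong (maybe′ _ _) eq

    act-involutive : Matching es → ∀ i z → act i es (act i es z) ≡ z
    act-involutive μ i z with edgeAt es z in eq
    ... | nothing = act-fixed eq
    ... | just (w , v) with lookup v i in vᵢ
    ...   | true  rewrite act-moved {i} (proj₂ (proj₂ (edgeAt-edge μ eq))) | vᵢ = refl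
    ...   | false rewrite act-moved {i} eq | vᵢ = refl

    act-commute : Matching es → ∀ i j z → act i es (act j es z) ≡ act j es (act i es z)
    act-commute μ i j z with edgeAt es z in eq
    ... | nothing = trans (act-fixed eq) (sym (act-fixed eq))
    ... | just (w , v) with _ , _ , eq′ ← edgeAt-edge μ eq | lookup v i in vᵢ | lookup v j in vⱼ
    ...   | true  | true  rewrite act-moved {i} eq′ | act-moved {j} eq′ | vᵢ | vⱼ = refl
    ...   | true  | false rewrite act-moved {i} eq  | act-moved {j} eq′ | vᵢ | vⱼ = refl
    ...   | false | true  rewrite act-moved {i} eq′ | act-moved {j} eq  | vᵢ | vⱼ = refl
    ...   | false | false rewrite act-moved {i} eq  | act-moved {j} eq  | vᵢ | vⱼ = refl

  act-edge : ∀ {es z w v} → Matching es → edgeAt es z ≡ just (w , v) → ∃ λ i → act i es z ≡ w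
  act-edge {es} {z} {w} μ eq with i , vᵢ ← proj₁ (proj₂ (edgeAt-edge μ eq)) =
    i , trans (act-moved {es} eq) (cong (if_then w else z) (Equivalence.to T-≡ vᵢ))

  act-linked : ∀ es i z → act i es z ≡ z ⊎ act i es z ≡ partner es z
  act-linked es i z with edgeAt es z
  ... | nothing = inj₁ refl
  ... | just (w , v) with lookup v i
  ...   | true  = inj₂ refl
  ...   | false = inj₁ refl

  partner-involutive : ∀ {es} → Matching es → ∀ z → partner es (partner es z) ≡ z
  partner-involutive {es} μ z with edgeAt es z in eq
  ... | nothing      = cong (maybe′ proj₁ z) eq
  ... | just (w , v) = cong (maybe′ proj₁ w) (proj₂ (proj₂ (edgeAt-edge μ eq)))

  toTuple-act : ∀ es i z → lookup (toTuple es) i ⟨ z ⟩ ≡ act i es z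
  toTuple-act es i z = trans (cong (λ f → f ⟨ z ⟩) (lookup∘tabulate _ i)) (lookup∘tabulate _ z)

  toTuple-∈-C : ∀ {es} → Matching es → toTuple es ∈ C p n
  toTuple-∈-C {es} μ =
    ∈-C (λ i → isPerm-intro {f = lookup σ i} (injective i)) (pairwiseCommute-intro {σ = σ} commuting)
    where
    open ≡-Reasoning
    σ : Vec (Map n) p
    σ = toTuple es
    injective : ∀ i {x y} → lookup σ i ⟨ x ⟩ ≡ lookup σ i ⟨ y ⟩ → x ≡ y
    injective i {x} {y} σᵢx≡σᵢy = begin
      x                           ≡⟨ act-involutive μ i x ⟨
      act i es (act i es x)       ≡⟨ cong (act i es) (toTuple-act es i x) ⟨
      act i es (lookup σ i ⟨ x ⟩) ≡⟨ cong (act i es) σᵢx≡σᵢy ⟩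
      act i es (lookup σ i ⟨ y ⟩) ≡⟨ cong (act i es) (toTuple-act es i y) ⟩
      act i es (act i es y)       ≡⟨ act-involutive μ i y ⟩
      y                           ∎
    commuting : ∀ i j x → lookup σ i ⟨ lookup σ j ⟨ x ⟩ ⟩ ≡ lookup σ j ⟨ lookup σ i ⟨ x ⟩ ⟩
    commuting i j x = begin
      lookup σ i ⟨ lookup σ j ⟨ x ⟩ ⟩ ≡⟨ toTuple-act es i _ ⟩
      act i es (lookup σ j ⟨ x ⟩)     ≡⟨ cong (act i es) (toTuple-act es j x) ⟩
      act i es (act j es x)           ≡⟨ act-commute μ i j x ⟩
      act j es (act i es x)           ≡⟨ cong (act j es) (toTuple-act es i x) ⟨
      act j es (lookup σ i ⟨ x ⟩)     ≡⟨ toTuple-act es j _ ⟨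
      lookup σ j ⟨ lookup σ i ⟨ x ⟩ ⟩ ∎

  toTuple-≡⇒act-≡ : ∀ {es es′} → toTuple es ≡ toTuple es′ → ∀ i z → act i es z ≡ act i es′ z
  toTuple-≡⇒act-≡ {es} {es′} eq i z =
    trans (sym (toTuple-act es i z)) (trans (cong (λ σ → lookup σ i ⟨ z ⟩) eq) (toTuple-act es′ i z))

  -- The partner of a moved point z is its image under any σᵢ that moves it, and its label
  -- records which σᵢ move it.
  toTuple-injective : ∀ {es es′} → Matching es → Matching es′ →
                      toTuple es ≡ toTuple es′ → edgeAt es ≗ edgeAt es′
  toTuple-injective {es} {es′} μ μ′ eq z with edgeAt es z in e | edgeAt es′ z in e′
  ... | nothing | nothing = refl
  ... | nothing | just _ with i , moves ← act-edge μ′ e′ =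
    contradiction (trans (sym moves) (trans (sym (toTuple-≡⇒act-≡ {es} {es′} eq i z)) (act-fixed {es} e)))
                  (proj₁ (edgeAt-edge μ′ e′))
  ... | just _ | nothing with i , moves ← act-edge μ e =
    contradiction (trans (sym moves) (trans (toTuple-≡⇒act-≡ {es} {es′} eq i z) (act-fixed {es′} e′)))
                  (proj₁ (edgeAt-edge μ e))
  ... | just (w , v) | just (w′ , v′) with i , moves ← act-edge μ e
    with lookup v′ i | trans (sym moves) (trans (toTuple-≡⇒act-≡ {es} {es′} eq i z) (act-moved {es′} {i} e′))
  ...   | false | w≡z  = contradiction w≡z (proj₁ (edgeAt-edge μ e))
  ...   | true  | refl = cong (λ v → just (w , v))
    (trans (sym (tabulate∘lookup v)) (trans (tabulate-cong same-label) (tabulate∘lookup v′)))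
    where
    same-label : ∀ j → lookup v j ≡ lookup v′ j
    same-label j = if-injective (proj₁ (edgeAt-edge μ e))
      (trans (sym (act-moved {es} e)) (trans (toTuple-≡⇒act-≡ {es} {es′} eq j z) (act-moved {es′} e′)))

  sameOrbit-partner : ∀ {es} → Matching es → ∀ z → T (sameOrbit (toTuple es) z (partner es z))
  sameOrbit-partner {es} μ z with edgeAt es z in eq
  ... | nothing = reach-refl n z
  ... | just _ with i , moves ← act-edge μ eq =
    subst (T ∘ sameOrbit (toTuple es) z) (trans (toTuple-act es i z) moves) (sameOrbit-generator i z)

  sameOrbit-linked : ∀ {es} → Matching es → ∀ {z w} → T (sameOrbit (toTuple es) z w) →
                     w ≡ z ⊎ w ≡ partner es z
  sameOrbit-linked {es} μ = reach-sound Linked (inj₁ refl) linked-trans step n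
    where
    Linked : Fin n → Fin n → Set
    Linked z w = w ≡ z ⊎ w ≡ partner es z
    linked-trans : Transitive Linked
    linked-trans     (inj₁ refl) u~w         = u~w
    linked-trans     (inj₂ u≡z′) (inj₁ w≡u)  = inj₂ (trans w≡u u≡z′)
    linked-trans {z} (inj₂ refl) (inj₂ w≡u′) = inj₁ (trans w≡u′ (partner-involutive μ z))
    step : ∀ i z → Linked z (lookup (toTuple es) i ⟨ z ⟩)
    step i z rewrite toTuple-act es i z = act-linked es i z

  upperEnd : EdgeList n p → Fin n → Bool
  upperEnd es z = toℕ (partner es z) <ᵇ toℕ z

  orbitMinimal-toTuple : ∀ {es} → Matching es → ∀ z → orbitMinimal (toTuple es) z ≡ not (upperEnd es z)
  orbitMinimal-toTuple {es} μ z with upperEnd es z in upper≡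
  ... | true  = ¬T⇒≡false λ minimal →
    T-not-∧⁻ (All.lookup (All.all⁺ _ (allFin n) minimal) (∈-allFin (partner es z)))
             (Equivalence.from T-≡ upper≡) (sameOrbit-partner μ z)
  ... | false = Equivalence.to T-≡ (all-intro (allFin n) λ y → T-not-∧⁺ λ y<z same →
    case sameOrbit-linked μ same of λ where
      (inj₁ refl) → contradiction y<z (subst T (<ᵇ-irrefl (toℕ z)))
      (inj₂ refl) → contradiction y<z (subst T upper≡))

  -- es is es′ with the edge s–t added, t being its larger endpoint.
  count-upperEnd-insert : ∀ {es es′ s t} → toℕ s < toℕ t →
    partner es s ≡ t → partner es t ≡ s → partner es′ s ≡ s → partner es′ t ≡ t →
    (∀ {z} → z ≢ s → z ≢ t → partner es z ≡ partner es′ z) →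
    count (upperEnd es) (allFin n) ≡ suc (count (upperEnd es′) (allFin n))
  count-upperEnd-insert {es} {es′} {s} {t} s<t es-s es-t es′-s es′-t es≗es′ =
    count-insert (Unique.allFin⁺ n) (∈-allFin t) upper-t upper′-t agree
    where
    below : ∀ es z {u} → partner es z ≡ u → upperEnd es z ≡ (toℕ u <ᵇ toℕ z)
    below es z = cong (λ w → toℕ w <ᵇ toℕ z)
    upper-t : upperEnd es t ≡ true
    upper-t = trans (below es t es-t) (Equivalence.to T-≡ (<⇒<ᵇ s<t))
    upper′-t : upperEnd es′ t ≡ false
    upper′-t = trans (below es′ t es′-t) (<ᵇ-irrefl (toℕ t))
    agree : ∀ {z} → z ≢ t → upperEnd es z ≡ upperEnd es′ z
    agree {z} z≢t with z ≟ s
    ... | yes refl =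
      trans (below es s es-s) (trans (<ᵇ-asym s<t) (sym (trans (below es′ s es′-s) (<ᵇ-irrefl (toℕ s)))))
    ... | no z≢s   = below es z (es≗es′ z≢s z≢t)

  count-upperEnd : ∀ {es} → Matching es → count (upperEnd es) (allFin n) ≡ length es
  count-upperEnd [] = count-none (All.universal (λ z → <ᵇ-irrefl (toℕ z)) (allFin n))
  count-upperEnd {(x , y , v) ∷ es} (add x≢y x-fresh y-fresh _ μ) = trans insert (cong suc (count-upperEnd μ))
    where
    e∷es : EdgeList n p
    e∷es = (x , y , v) ∷ es
    partner-x : partner e∷es x ≡ y
    partner-x = cong (maybe′ proj₁ x) (edgeAt-left {x} {y} {v} {es})
    partner-y : partner e∷es y ≡ x
    partner-y = cong (maybe′ proj₁ y) (edgeAt-right {x} {y} {v} {es} x≢y)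
    partner-fresh : ∀ {u} → Fresh u es → partner es u ≡ u
    partner-fresh u-fresh = cong (maybe′ proj₁ _) (edgeAt-fresh u-fresh)
    partner-other : ∀ {z} → z ≢ x → z ≢ y → partner e∷es z ≡ partner es z
    partner-other z≢x z≢y = cong (maybe′ proj₁ _) (edgeAt-other z≢x z≢y)
    insert : count (upperEnd e∷es) (allFin n) ≡ suc (count (upperEnd es) (allFin n))
    insert with <-cmpᶠ x y
    ... | tri< x<y _ _ = count-upperEnd-insert {e∷es} {es} x<y partner-x partner-y
                           (partner-fresh x-fresh) (partner-fresh y-fresh) partner-other
    ... | tri≈ _ x≡y _ = contradiction x≡y x≢y
    ... | tri> _ _ y<x = count-upperEnd-insert {e∷es} {es} y<x partner-y partner-x
                           (partner-fresh y-fresh) (partner-fresh x-fresh) (λ z≢y z≢x → partner-other z≢x z≢y)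

  numOrbits-toTuple : ∀ {es} → Matching es → numOrbits (toTuple es) ≡ n ∸ length es
  numOrbits-toTuple {es} μ = begin
    numOrbits (toTuple es)                      ≡⟨ count-cong (All.universal (orbitMinimal-toTuple μ) (allFin n)) ⟩
    count (not ∘ upperEnd es) (allFin n)         ≡⟨ m+n∸n≡m _ (count (upperEnd es) (allFin n)) ⟨
    count (not ∘ upperEnd es) (allFin n) + count (upperEnd es) (allFin n) ∸ count (upperEnd es) (allFin n)
      ≡⟨ cong₂ _∸_ (trans (count-complement (upperEnd es) (allFin n)) (length-tabulate id)) (count-upperEnd μ) ⟩
    n ∸ length es                                ∎
    where open ≡-Reasoning

  mutual
    matchings : ∀ {m} → Vec (Fin n) m → ℕ → List (EdgeList n p)
    matchings               _                  zero    = [ [] ]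
    matchings               []ᵛ                (suc α) = []
    matchings               (_ ∷ᵛ []ᵛ)         (suc α) = []
    matchings {suc (suc m)} (x ∷ᵛ xs@(_ ∷ᵛ _)) (suc α) =
      matchings xs (suc α) ++ concatMap (matchingsWith x α) (picks xs)

    matchingsWith : ∀ {m} → Fin n → ℕ → Fin n × Vec (Fin n) m → List (EdgeList n p)
    matchingsWith x α (y , ys) = concatMap (λ v → map ((x , y , v) ∷_) (matchings ys α)) (nonzeroBitVectors p)

  length-matchings : ∀ {m} (xs : Vec (Fin n) m) α → length (matchings xs α) ≡ matchingCount (2 ^ p ∸ 1) m α
  length-matchings               _                  zero    = refl
  length-matchings               []ᵛ                (suc α) = refl
  length-matchings               (_ ∷ᵛ []ᵛ)         (suc α) = refl
  length-matchings {suc (suc m)} (x ∷ᵛ xs@(_ ∷ᵛ _)) (suc α) = begin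
    length (matchings xs (suc α) ++ concatMap (matchingsWith x α) (picks xs))
      ≡⟨ length-++ (matchings xs (suc α)) ⟩
    length (matchings xs (suc α)) + length (concatMap (matchingsWith x α) (picks xs))
      ≡⟨ cong₂ _+_ (length-matchings xs (suc α)) (length-concatMap _ length-matchingsWith (picks xs)) ⟩
    matchingCount c (suc m) (suc α) + length (picks xs) * (c * matchingCount c m α)
      ≡⟨ cong (λ k → matchingCount c (suc m) (suc α) + k * (c * matchingCount c m α)) (length-picks xs) ⟩
    matchingCount c (suc m) (suc α) + suc m * (c * matchingCount c m α) ∎
    where
    open ≡-Reasoning
    c : ℕ
    c = 2 ^ p ∸ 1
    length-matchingsWith : ∀ y,ys → length (matchingsWith x α y,ys) ≡ c * matchingCount c m α
    length-matchingsWith (y , ys) = trans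
      (length-concatMap _ (λ v → trans (length-map _ (matchings ys α)) (length-matchings ys α)) (nonzeroBitVectors p))
      (cong (_* matchingCount c m α) (length-nonzeroBitVectors p))

  record MatchingOn {m} (xs : Vec (Fin n) m) (α : ℕ) (es : EdgeList n p) : Set where
    field
      matching : Matching es
      avoids   : ∀ {z} → Allᵛ (z ≢_) xs → Fresh z es
      size     : length es ≡ α
  open MatchingOn

  matchings-sound : ∀ {m} (xs : Vec (Fin n) m) α → Uniqueᵛ xs → All (MatchingOn xs α) (matchings xs α)
  matchings-sound _          zero    _ = record { matching = [] ; avoids = λ _ → [] ; size = refl } ∷ []
  matchings-sound []ᵛ        (suc α) _ = []
  matchings-sound (_ ∷ᵛ []ᵛ) (suc α) _ = []
  matchings-sound (x ∷ᵛ xs@(_ ∷ᵛ _)) (suc α) (x∉xs ∷ u) =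
    All.++⁺ (All.map unmatched (matchings-sound xs (suc α) u)) (All-concatMap⁺ (All.map matched (picks-Pick xs)))
    where
    unmatched : ∀ {es} → MatchingOn xs (suc α) es → MatchingOn (x ∷ᵛ xs) (suc α) es
    unmatched mo .matching                 = matching mo
    unmatched mo .avoids (_ Allᵛ.∷ z∉xs) = avoids mo z∉xs
    unmatched mo .size                     = size mo
    matched : ∀ {y ys} → Pick xs y ys → All (MatchingOn (x ∷ᵛ xs) (suc α)) (matchingsWith x α (y , ys))
    matched {y} {ys} pick with x≢y Allᵛ.∷ x∉ys ← Pick-avoids pick x∉xs | y∉ys ∷ u′ ← Pick-unique pick u =
      All-concatMap⁺ (All.map (λ nz → All.map⁺ (All.map (extend nz) (matchings-sound ys α u′)))
                              (nonzeroBitVectors-nonzero p))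
      where
      extend : ∀ {v es} → Nonzero v → MatchingOn ys α es → MatchingOn (x ∷ᵛ xs) (suc α) ((x , y , v) ∷ es)
      extend nz mo .matching = add x≢y (avoids mo x∉ys) (avoids mo y∉ys) nz (matching mo)
      extend nz mo .avoids (z≢x Allᵛ.∷ z∉xs) with z≢y Allᵛ.∷ z∉ys ← Pick-avoids pick z∉xs =
        (z≢x , z≢y) ∷ avoids mo z∉ys
      extend nz mo .size = cong suc (size mo)

  Apart : EdgeList n p → EdgeList n p → Set
  Apart es es′ = ¬ (edgeAt es ≗ edgeAt es′)

  Apart-extend : ∀ {x y v es es′} → Fresh x es → Fresh y es → Fresh x es′ → Fresh y es′ →
                 Apart es es′ → Apart ((x , y , v) ∷ es) ((x , y , v) ∷ es′)
  Apart-extend {x} {y} {v} {es} {es′} x∉es y∉es x∉es′ y∉es′ apart same = apart agree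
    where
    agree : edgeAt es ≗ edgeAt es′
    agree z with z ≟ x | z ≟ y
    ... | yes refl | _        = trans (edgeAt-fresh x∉es) (sym (edgeAt-fresh x∉es′))
    ... | no _     | yes refl = trans (edgeAt-fresh y∉es) (sym (edgeAt-fresh y∉es′))
    ... | no z≢x   | no z≢y   = trans (sym (edgeAt-other z≢x z≢y)) (trans (same z) (edgeAt-other z≢x z≢y))

  Apart-byKey : ∀ {K : Set} (key : Maybe (Fin n × Vec Bool p) → K) x {k k′ as bs} → k ≢ k′ →
                All (λ a → key (edgeAt a x) ≡ k) as → All (λ b → key (edgeAt b x) ≡ k′) bs →
                All (λ a → All (Apart a) bs) as
  Apart-byKey key x k≢k′ keys keys′ =
    All.map (λ ka → All.map (λ kb same → k≢k′ (trans (sym ka) (trans (cong key (same x)) kb))) keys′) keys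

  -- Two matchings in the list are told apart by the edge at the first point x where their
  -- construction branches: x unmatched or not, its partner, or its label.
  matchings-apart : ∀ {m} (xs : Vec (Fin n) m) α → Uniqueᵛ xs → AllPairs Apart (matchings xs α)
  matchings-apart _          zero    _ = [] ∷ []
  matchings-apart []ᵛ        (suc α) _ = []
  matchings-apart (_ ∷ᵛ []ᵛ) (suc α) _ = []
  matchings-apart {suc (suc m)} (x ∷ᵛ xs@(_ ∷ᵛ _)) (suc α) (x∉xs ∷ u) =
    AllPairs.++⁺ (matchings-apart xs (suc α) u)
                 (AllPairs-concatMap⁺ (All.map within (picks-Pick xs)) (AllPairs.map across (picks-distinct u)))
                 (Apart-byKey is-just x (λ ()) unmatched-key
                   (All-concatMap⁺ (All.universal (λ y,ys → matched-key is-just y,ys λ _ → refl) (picks xs))))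
    where
    unmatched-key : All (λ a → is-just (edgeAt a x) ≡ false) (matchings xs (suc α))
    unmatched-key = All.map (λ mo → cong is-just (edgeAt-fresh (avoids mo x∉xs))) (matchings-sound xs (suc α) u)
    matched-key : ∀ {K : Set} (key : Maybe (Fin n × Vec Bool p) → K) {k} ((y , ys) : Fin n × Vec (Fin n) m) →
                  (∀ v → key (just (y , v)) ≡ k) → All (λ b → key (edgeAt b x) ≡ k) (matchingsWith x α (y , ys))
    matched-key key (y , ys) key-y = All-concatMap⁺ (All.universal (λ v → All.map⁺ (All.universal
      (λ es → trans (cong key (edgeAt-left {x} {y} {v} {es})) (key-y v)) (matchings ys α))) (nonzeroBitVectors p))
    across : ∀ {y,ys y′,ys′} → proj₁ y,ys ≢ proj₁ y′,ys′ →
             All (λ a → All (Apart a) (matchingsWith x α y′,ys′)) (matchingsWith x α y,ys)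
    across {y,ys} {y′,ys′} y≢y′ = Apart-byKey (Maybe.map proj₁) x (y≢y′ ∘ just-injective)
      (matched-key (Maybe.map proj₁) y,ys λ _ → refl) (matched-key (Maybe.map proj₁) y′,ys′ λ _ → refl)
    within : ∀ {y ys} → Pick xs y ys → AllPairs Apart (matchingsWith x α (y , ys))
    within {y} {ys} pick with _ Allᵛ.∷ x∉ys ← Pick-avoids pick x∉xs | y∉ys ∷ u′ ← Pick-unique pick u =
      AllPairs-concatMap⁺
        (All.universal (λ _ → AllPairs.map⁺ (AllPairs-mapWithAll extend (matchings-sound ys α u′)
                                                                         (matchings-apart ys α u′)))
                       (nonzeroBitVectors p))
        (AllPairs.map (λ v≢v′ → Apart-byKey (Maybe.map proj₂) x (v≢v′ ∘ just-injective) (label-key _) (label-key _))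
                      (Unique-nonzeroBitVectors p))
      where
      extend : ∀ {v es es′} → MatchingOn ys α es → MatchingOn ys α es′ →
               Apart es es′ → Apart ((x , y , v) ∷ es) ((x , y , v) ∷ es′)
      extend mo mo′ = Apart-extend (avoids mo x∉ys) (avoids mo y∉ys) (avoids mo′ x∉ys) (avoids mo′ y∉ys)
      label-key : ∀ v → All (λ b → Maybe.map proj₂ (edgeAt b x) ≡ just v) (map ((x , y , v) ∷_) (matchings ys α))
      label-key v =
        All.map⁺ (All.universal (λ es → cong (Maybe.map proj₂) (edgeAt-left {x} {y} {v} {es})) (matchings ys α))

matchingCount≤A : ∀ p n α → matchingCount (2 ^ p ∸ 1) n α ≤ A p n (n ∸ α)
matchingCount≤A p n α = begin
  matchingCount (2 ^ p ∸ 1) n α           ≡⟨ length-matchings pool α ⟨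
  length (matchings pool α)               ≡⟨ length-map toTuple (matchings pool α) ⟨
  length (map toTuple (matchings pool α)) ≤⟨ Unique-⊆⇒length≤ distinct tuples⊆ ⟩
  A p n (n ∸ α)                           ∎
  where
  open ≤-Reasoning
  open MatchingOn
  pool : Vec (Fin n) n
  pool = allFinᵛ n
  unique : Uniqueᵛ pool
  unique = Uniqueᵛ.tabulate⁺ id
  sound : All (MatchingOn pool α) (matchings {p = p} pool α)
  sound = matchings-sound pool α unique
  distinct : Unique (map toTuple (matchings pool α))
  distinct = AllPairs.map⁺ (AllPairs-mapWithAll
    (λ mo mo′ apart same → apart (toTuple-injective (matching mo) (matching mo′) same))
    sound (matchings-apart pool α unique))
  tuples⊆ : map toTuple (matchings pool α) ⊆ filter (λ σ → numOrbits σ Data.Nat.≟ (n ∸ α)) (C p n)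
  tuples⊆ σ∈ with es , es∈ , refl ← ∈-map⁻ toTuple σ∈ with mo ← All.lookup sound es∈ =
    ∈-filter⁺ _ (toTuple-∈-C (matching mo)) (trans (numOrbits-toTuple (matching mo)) (cong (n ∸_) (size mo)))

lemma2p1 : (α p n : ℕ) → 3 ≤ α → 2 ≤ p → 2 * α ≤ n →
    A p n (n ∸ α) * (α ! * (n ∸ 2 * α) ! * 2 ^ α) ≥ n ! * (2 ^ p ∸ 1) ^ α
lemma2p1 α p n _ _ 2α≤n with r , refl ← m≤n⇒∃[o]m+o≡n 2α≤n = begin
  (2 * α + r) ! * c ^ α                               ≡⟨ matchingCount-closed c α r ⟨
  matchingCount c (2 * α + r) α * (α ! * r ! * 2 ^ α) ≤⟨ *-monoˡ-≤ _ (matchingCount≤A p (2 * α + r) α) ⟩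
  A′ * (α ! * r ! * 2 ^ α)                            ≡⟨ cong (λ k → A′ * (α ! * k ! * 2 ^ α)) r≡ ⟩
  A′ * (α ! * (2 * α + r ∸ 2 * α) ! * 2 ^ α)          ∎
  where
  open ≤-Reasoning
  c : ℕ
  c = 2 ^ p ∸ 1
  A′ : ℕ
  A′ = A p (2 * α + r) (2 * α + r ∸ α)
  r≡ : r ≡ 2 * α + r ∸ 2 * α
  r≡ = sym (m+n∸m≡n (2 * α) r)
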